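{- For all $k,\Delta\in\mathbb{N}$, every graph $G$ with treewidth less than $k$ and maximum degree at most $\Delta$ has a circular drawing $D$ whose crossing graph $X_D$ has treewidth at most $(6\Delta+1)(18k\Delta)^2-1$.
   Context: A circular drawing of a graph $G$ places the vertices at distinct points on a circle and draws each edge as the straight line segment between its endpoints. Two edges cross if their segments intersect at a point that is not an endpoint of either. The crossing graph $X_D$ has vertex set $E(G)$, two edges adjacent iff they cross in $D$. -}

module Defs where

open import Data.Nat using (ℕ; zero; suc; _+_; _*_; _≤_; _<_; _⊓_; _⊔_)
open import Data.Fin using (Fin; toℕ) renaming (zero to fzero; suc to fsuc)
open import Data.List using (List; length; map; allFin)
open import Data.Nat.ListAction using (sum)
open import Data.List.Membership.Propositional using (_∈_)
open import Data.Bool using (Bool; true; false; if_then_else_)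
open import Data.Product using (Σ; ∃; ∃-syntax; _×_; _,_)
open import Data.Sum using (_⊎_)
open import Function.Definitions using (Injective)
open import Relation.Binary.PropositionalEquality using (_≡_)

record Graph : Set where
  field
    n    : ℕ
    adj  : Fin n → Fin n → Bool
    sym  : ∀ u v → adj u v ≡ adj v u
    irr  : ∀ v → adj v v ≡ false

module _ (G : Graph) where
  open Graph G

  degree : Fin n → ℕ
  degree v = sum (map (λ u → if adj v u then 1 else 0) (allFin n))

  MaxDegreeAtMost : ℕ → Set
  MaxDegreeAtMost Δ = ∀ v → degree v ≤ Δ

  -- an edge {u,v}, represented once with u < v
  record Edge : Set where
    constructor edge
    field
      u   : Fin n
      v   : Fin n
      u<v : toℕ u < toℕ v
      uv  : adj u v ≡ true

  Adj : Fin n → Fin n → Set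
  Adj u v = adj u v ≡ true

data WalkIn {A : Set} (R : A → A → Set) (S : A → Set) : A → A → Set where
  here : ∀ {x} → S x → WalkIn R S x x
  step : ∀ {x y z} → S x → R x y → WalkIn R S y z → WalkIn R S x z

ConnectedSubset : {A : Set} → (A → A → Set) → (A → Set) → Set
ConnectedSubset {A} R S = ∀ (x y : A) → S x → S y → WalkIn R S x y

-- Trees: nodes Fin (suc m), node (fsuc i) is joined to its parent
-- (parent i), which has smaller index.  Every finite nonempty tree is
-- isomorphic to one of this form (number the nodes in BFS order).

data TreeAdj {m : ℕ} (parent : Fin m → Fin (suc m)) : Fin (suc m) → Fin (suc m) → Set where
  up   : ∀ i → TreeAdj parent (fsuc i) (parent i)
  down : ∀ i → TreeAdj parent (parent i) (fsuc i)

record TreeDecomposition (V : Set) (_~_ : V → V → Set) : Set where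
  field
    m          : ℕ
    parent     : Fin m → Fin (suc m)
    parent<    : ∀ i → toℕ (parent i) ≤ toℕ i
    bag        : Fin (suc m) → List V
    vertexCov  : ∀ v → ∃[ t ] (v ∈ bag t)
    edgeCov    : ∀ u v → u ~ v → ∃[ t ] (u ∈ bag t × v ∈ bag t)
    coherent   : ∀ v → ConnectedSubset (TreeAdj parent) (λ t → v ∈ bag t)

-- treewidth < b  :  some tree decomposition has all bags of size ≤ b
-- (i.e. width = max bag size − 1 ≤ b − 1).
TreewidthLessThan : (V : Set) → (V → V → Set) → ℕ → Set
TreewidthLessThan V _~_ b =
  Σ (TreeDecomposition V _~_) λ T → ∀ t → length (TreeDecomposition.bag T t) ≤ b

-- Only the cyclic order of the vertices on the
-- circle matters for crossings of chords, so a circular drawing is an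
-- injective placement pos : Fin n → Fin n (positions around the circle).
-- Two chords cross (in an interior point) iff their endpoints are four
-- distinct points that interleave around the circle.

module _ (G : Graph) where
  open Graph G

  CircularDrawing : Set
  CircularDrawing = Σ (Fin n → Fin n) Injective′
    where Injective′ : (Fin n → Fin n) → Set
          Injective′ f = Injective _≡_ _≡_ f

  Interleave : ℕ → ℕ → ℕ → ℕ → Set
  Interleave a b c d = (a < c × c < b × b < d) ⊎ (c < a × a < d × d < b)

  Cross : CircularDrawing → Edge G → Edge G → Set
  Cross (pos , _) e f =
    Interleave (P a₁ ⊓ P b₁) (P a₁ ⊔ P b₁) (P a₂ ⊓ P b₂) (P a₂ ⊔ P b₂)
    where
      open Edge e renaming (u to a₁; v to b₁)
      open Edge f renaming (u to a₂; v to b₂)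
      P : Fin n → ℕ
      P x = toℕ (pos x)

{-# OPTIONS --safe #-}
-- Lay the vertices out in depth-first order of a tree decomposition with bags of size ≤ k:
-- a vertex is keyed by the root path of the topmost bag containing it (its home), followed
-- by the vertex itself. The vertices homed in a subtree then occupy an interval of the
-- circle, so every edge crossing an edge f has an endpoint homed in the subtree of r_f, the
-- home of the higher endpoint of f. Applied to both of two crossing edges e and f, this makes
-- r_e and r_f comparable; if r_f is an ancestor of r_e, coherence of the bags puts the higher
-- endpoint of f into the bag at r_e, next to that of e. Hence replacing each vertex of a bag
-- by its at most Δ incident edges gives a tree decomposition of the crossing graph with bags
-- of size ≤ kΔ, well within the claimed bound.
module Submission where

open import Defs
open import Data.Nat using (ℕ; zero; suc; _+_; _*_; _^_; _≤_; _<_; _⊓_; _⊔_; z≤n; s≤s)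
open import Data.Nat.Properties
  using ( ≤-refl; ≤-trans; ≤-reflexive; ≤-<-trans; <-≤-trans; <-asym; <-cmp; <-irrelevant; <⇒≢; >⇒≢
        ; m≤n⇒m≤1+n; m≤m+n; m≤n+m; m≤m*n; m≤n*m; +-mono-≤; *-monoˡ-≤; +-cancelˡ-≡
        ; *-assoc; *-identityˡ; *-identityʳ; ⊓-sel; ⊔-sel; <-isStrictTotalOrder; module ≤-Reasoning)
open import Data.Fin using (Fin; toℕ; fromℕ<) renaming (zero to fzero; suc to fsuc)
open import Data.Fin.Properties using (toℕ-injective; toℕ-fromℕ<; toℕ<n)
open import Data.List using (List; []; _∷_; _++_; _∷ʳ_; length; map; filter; allFin; concatMap)
open import Data.Nat.ListAction using (sum)
open import Data.Bool using (true; false; if_then_else_)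
import Data.Bool
open import Axiom.UniquenessOfIdentityProofs using (module Decidable⇒UIP)
open import Data.List.Properties using (∷ʳ-injectiveʳ; length-tabulate; length-++; filter-notAll; map-cong)
open import Data.List.Membership.Propositional using (_∈_; lose; find)
open import Data.List.Membership.Propositional.Properties using (∈-allFin; ∈-concatMap⁺; ∈-concatMap⁻)
open import Data.List.Relation.Unary.Any using (Any; here; there; satisfied)
open import Data.List.Relation.Binary.Pointwise using (Pointwise; Pointwise-≡⇒≡; ≡⇒Pointwise-≡)
open import Data.List.Relation.Binary.Prefix.Heterogeneous using (Prefix; []; _∷_; _++ᵖ_)
import Data.List.Relation.Binary.Prefix.Heterogeneous.Properties as Prefix
open import Data.List.Relation.Binary.Lex.Core using (Lex-<; this; next)
import Data.List.Relation.Binary.Lex.Strict as Lex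
open import Data.Product using (Σ; ∃; ∃-syntax; _×_; _,_; proj₁; proj₂)
open import Data.Sum using (_⊎_; inj₁; inj₂; [_,_]′)
open import Relation.Binary.Core using (Rel)
open import Relation.Binary.Definitions using (Asymmetric; DecidableEquality; tri<; tri≈; tri>)
open import Relation.Binary.Structures using (IsStrictTotalOrder)
open import Relation.Binary.PropositionalEquality
open import Relation.Nullary using (¬_; Dec; yes; no; contradiction)
open import Relation.Unary using (Pred; Decidable; _⊆_; _∪_)

module _ {A : Set} where

  infix 4 _⊑_

  _⊑_ : List A → List A → Set
  _⊑_ = Prefix _≡_

  ⊑-refl : ∀ {xs} → xs ⊑ xs
  ⊑-refl = Prefix.fromPointwise (≡⇒Pointwise-≡ refl)

  ⊑-trans : ∀ {xs ys zs} → xs ⊑ ys → ys ⊑ zs → xs ⊑ zs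
  ⊑-trans = Prefix.trans trans

  ⊑-antisym : ∀ {xs ys} → xs ⊑ ys → ys ⊑ xs → xs ≡ ys
  ⊑-antisym p q = Pointwise-≡⇒≡ (Prefix.antisym (λ e _ → e) p q)

  ⊑-∷ʳ : ∀ {xs y} → xs ⊑ xs ∷ʳ y
  ⊑-∷ʳ = ⊑-refl ++ᵖ _

  ⊑-∷ʳ⁻ : ∀ {xs ys y} → xs ⊑ ys ∷ʳ y → xs ⊑ ys ⊎ xs ≡ ys ∷ʳ y
  ⊑-∷ʳ⁻ {ys = []}    []             = inj₁ []
  ⊑-∷ʳ⁻ {ys = []}    (refl ∷ [])    = inj₂ refl
  ⊑-∷ʳ⁻ {ys = _ ∷ _} []             = inj₁ []
  ⊑-∷ʳ⁻ {ys = y ∷ _} (refl ∷ p) with ⊑-∷ʳ⁻ p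
  ... | inj₁ q = inj₁ (refl ∷ q)
  ... | inj₂ e = inj₂ (cong (y ∷_) e)

  ⊑-comparable : ∀ {xs ys zs} → xs ⊑ zs → ys ⊑ zs → xs ⊑ ys ⊎ ys ⊑ xs
  ⊑-comparable []         _          = inj₁ []
  ⊑-comparable (_ ∷ _)    []         = inj₂ []
  ⊑-comparable (refl ∷ p) (refl ∷ q) with ⊑-comparable p q
  ... | inj₁ r = inj₁ (refl ∷ r)
  ... | inj₂ r = inj₂ (refl ∷ r)

  ⊑-convex : ∀ {ℓ} {_<_ : Rel A ℓ} → Asymmetric _<_ → ∀ {q xs ys zs} →
             q ⊑ xs → q ⊑ zs → Lex-< _≡_ _<_ xs ys → Lex-< _≡_ _<_ ys zs → q ⊑ ys
  ⊑-convex asym []         _          _               _               = []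
  ⊑-convex asym (refl ∷ _) (refl ∷ _) (this x<y)      (this y<x)      = contradiction y<x (asym x<y)
  ⊑-convex asym (refl ∷ _) (refl ∷ _) (this x<x)      (next refl _)   = contradiction x<x (asym x<x)
  ⊑-convex asym (refl ∷ _) (refl ∷ _) (next refl _)   (this x<x)      = contradiction x<x (asym x<x)
  ⊑-convex asym (refl ∷ p) (refl ∷ r) (next refl xs<ys) (next refl ys<zs) =
    refl ∷ ⊑-convex asym p r xs<ys ys<zs

module _ {A : Set} {ℓ} {P Q : Pred A ℓ} (P? : Decidable P) (Q? : Decidable Q) (P⊆Q : P ⊆ Q) where

  length-filter-mono-≤ : ∀ xs → length (filter P? xs) ≤ length (filter Q? xs)
  length-filter-mono-≤ [] = z≤n
  length-filter-mono-≤ (x ∷ xs) with P? x | Q? x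
  ... | yes _ | yes _ = s≤s (length-filter-mono-≤ xs)
  ... | yes p | no ¬q = contradiction (P⊆Q p) ¬q
  ... | no _  | yes _ = m≤n⇒m≤1+n (length-filter-mono-≤ xs)
  ... | no _  | no _  = length-filter-mono-≤ xs

  length-filter-mono-< : ∀ {xs} → Any (λ x → Q x × ¬ P x) xs →
                         length (filter P? xs) < length (filter Q? xs)
  length-filter-mono-< {x ∷ xs} (here (q , ¬p)) with P? x | Q? x
  ... | yes p | _     = contradiction p ¬p
  ... | no _  | yes _ = s≤s (length-filter-mono-≤ xs)
  ... | no _  | no ¬q = contradiction q ¬q
  length-filter-mono-< {x ∷ xs} (there any) with P? x | Q? x
  ... | yes _ | yes _ = s≤s (length-filter-mono-< any)
  ... | yes p | no ¬q = contradiction (P⊆Q p) ¬q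
  ... | no _  | yes _ = m≤n⇒m≤1+n (length-filter-mono-< any)
  ... | no _  | no _  = length-filter-mono-< any

module Rank {n ℓ₁ ℓ₂} {K : Set} {_≈_ : Rel K ℓ₁} {_≺_ : Rel K ℓ₂}
            (sto : IsStrictTotalOrder _≈_ _≺_)
            (key : Fin n → K) (key-injective : ∀ {x y} → key x ≈ key y → x ≡ y) where

  open IsStrictTotalOrder sto using (_<?_; compare; irrefl; module Eq) renaming (trans to ≺-trans)

  rankℕ : Fin n → ℕ
  rankℕ x = length (filter (λ y → key y <? key x) (allFin n))

  rankℕ<n : ∀ x → rankℕ x < n
  rankℕ<n x = subst (rankℕ x <_) (length-tabulate (λ y → y))
    (filter-notAll _ (allFin n) (lose (∈-allFin x) (irrefl Eq.refl)))

  rank : Fin n → Fin n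
  rank x = fromℕ< (rankℕ<n x)

  rank-mono : ∀ {x y} → key x ≺ key y → toℕ (rank x) < toℕ (rank y)
  rank-mono {x} {y} x≺y = begin-strict
    toℕ (rank x) ≡⟨ toℕ-fromℕ< (rankℕ<n x) ⟩
    rankℕ x      <⟨ length-filter-mono-< (λ z → key z <? key x) (λ z → key z <? key y)
                      (λ z≺x → ≺-trans z≺x x≺y) (lose (∈-allFin x) (x≺y , irrefl Eq.refl)) ⟩
    rankℕ y      ≡⟨ toℕ-fromℕ< (rankℕ<n y) ⟨
    toℕ (rank y) ∎
    where open ≤-Reasoning

  rank-reflects : ∀ {x y} → toℕ (rank x) < toℕ (rank y) → key x ≺ key y
  rank-reflects {x} {y} lt with compare (key x) (key y)
  ... | tri< x≺y _ _ = x≺y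
  ... | tri≈ _ x≈y _ = contradiction (cong (λ z → toℕ (rank z)) (key-injective x≈y)) (<⇒≢ lt)
  ... | tri> _ _ y≺x = contradiction (rank-mono y≺x) (<-asym lt)

  rank-injective : ∀ {x y} → rank x ≡ rank y → x ≡ y
  rank-injective {x} {y} e with compare (key x) (key y)
  ... | tri< x≺y _ _ = contradiction (cong toℕ e) (<⇒≢ (rank-mono x≺y))
  ... | tri≈ _ x≈y _ = key-injective x≈y
  ... | tri> _ _ y≺x = contradiction (cong toℕ (sym e)) (<⇒≢ (rank-mono y≺x))

module _ {A : Set} {R : A → A → Set} where

  walk-start : ∀ {S x y} → WalkIn R S x y → S x
  walk-start (here s)     = s
  walk-start (step s _ _) = s

  walk-map : ∀ {S S′} → S ⊆ S′ → ∀ {x y} → WalkIn R S x y → WalkIn R S′ x y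
  walk-map S⊆S′ (here s)     = here (S⊆S′ s)
  walk-map S⊆S′ (step s r w) = step (S⊆S′ s) r (walk-map S⊆S′ w)

  walk-++ : ∀ {S x y z} → WalkIn R S x y → WalkIn R S y z → WalkIn R S x z
  walk-++ (here _)     w′ = w′
  walk-++ (step s r w) w′ = step s r (walk-++ w w′)

  connected-∪ : ∀ {S₁ S₂ z} → ConnectedSubset R S₁ → ConnectedSubset R S₂ → S₁ z → S₂ z →
                ConnectedSubset R (S₁ ∪ S₂)
  connected-∪ c₁ c₂ z₁ z₂ x y (inj₁ x₁) (inj₁ y₁) = walk-map inj₁ (c₁ x y x₁ y₁)
  connected-∪ c₁ c₂ z₁ z₂ x y (inj₂ x₂) (inj₂ y₂) = walk-map inj₂ (c₂ x y x₂ y₂)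
  connected-∪ {z = z} c₁ c₂ z₁ z₂ x y (inj₁ x₁) (inj₂ y₂) =
    walk-++ (walk-map inj₁ (c₁ x z x₁ z₁)) (walk-map inj₂ (c₂ z y z₂ y₂))
  connected-∪ {z = z} c₁ c₂ z₁ z₂ x y (inj₂ x₂) (inj₁ y₁) =
    walk-++ (walk-map inj₂ (c₂ x z x₂ z₂)) (walk-map inj₁ (c₁ z y z₁ y₁))

  connected-resp : ∀ {S S′} → S ⊆ S′ → S′ ⊆ S → ConnectedSubset R S → ConnectedSubset R S′
  connected-resp S⊆S′ S′⊆S c x y x′ y′ = walk-map S⊆S′ (c x y (S′⊆S x′) (S′⊆S y′))

⊓-elim : ∀ {ℓ} (P : ℕ → Set ℓ) {m n} → P m → P n → P (m ⊓ n)
⊓-elim P {m} {n} pm pn with ⊓-sel m n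
... | inj₁ e = subst P (sym e) pm
... | inj₂ e = subst P (sym e) pn

⊔-elim : ∀ {ℓ} (P : ℕ → Set ℓ) {m n} → P m → P n → P (m ⊔ n)
⊔-elim P {m} {n} pm pn with ⊔-sel m n
... | inj₁ e = subst P (sym e) pm
... | inj₂ e = subst P (sym e) pn

ConvexAlong : {V : Set} → (V → ℕ) → (V → Set) → Set
ConvexAlong f S = ∀ {x y z} → S x → S z → f x < f y → f y < f z → S y

module _ {V : Set} (f : V → ℕ) (S : V → Set) (convex : ConvexAlong f S) where

  strictly-within : ∀ {c d y} → S c → S d → f c ⊓ f d < f y → f y < f c ⊔ f d → S y
  strictly-within {c} {d} {y} Sc Sd =
    ⊓-elim (λ lo → lo < f y → f y < f c ⊔ f d → S y)
      (λ c<y → ⊔-elim (λ hi → f y < hi → S y) (convex Sc Sc c<y) (convex Sc Sd c<y))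
      (λ d<y → ⊔-elim (λ hi → f y < hi → S y) (convex Sd Sc d<y) (convex Sd Sd d<y))

  crossing-chord-enters : ∀ G a b {c d} → S c → S d →
    Interleave G (f a ⊓ f b) (f a ⊔ f b) (f c ⊓ f d) (f c ⊔ f d) → S a ⊎ S b
  crossing-chord-enters G a b {c} {d} Sc Sd (inj₁ (_ , lo<hi₁ , hi₁<hi)) =
    ⊔-elim (λ hi₁ → f c ⊓ f d < hi₁ → hi₁ < f c ⊔ f d → S a ⊎ S b)
      (λ lo<a a<hi → inj₁ (strictly-within Sc Sd lo<a a<hi))
      (λ lo<b b<hi → inj₂ (strictly-within Sc Sd lo<b b<hi)) lo<hi₁ hi₁<hi
  crossing-chord-enters G a b {c} {d} Sc Sd (inj₂ (lo<lo₁ , lo₁<hi , _)) =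
    ⊓-elim (λ lo₁ → f c ⊓ f d < lo₁ → lo₁ < f c ⊔ f d → S a ⊎ S b)
      (λ lo<a a<hi → inj₁ (strictly-within Sc Sd lo<a a<hi))
      (λ lo<b b<hi → inj₂ (strictly-within Sc Sd lo<b b<hi)) lo<lo₁ lo₁<hi

Interleave-sym : ∀ G {a b c d} → Interleave G a b c d → Interleave G c d a b
Interleave-sym G (inj₁ p) = inj₂ p
Interleave-sym G (inj₂ p) = inj₁ p

module RootPath (offset : ℕ) {m : ℕ} (parent : Fin m → Fin (suc m))
                (parent≤ : ∀ i → toℕ (parent i) ≤ toℕ i) where

  Node : Set
  Node = Fin (suc m)

  label : Node → ℕ
  label s = offset + toℕ s

  -- parent is not structurally smaller, so the recursion runs on fuel; any fuel above the
  -- index of the node gives the same path.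
  pathWithin : ℕ → Node → List ℕ
  pathWithin zero    _        = []
  pathWithin (suc f) fzero    = label fzero ∷ []
  pathWithin (suc f) (fsuc i) = pathWithin f (parent i) ∷ʳ label (fsuc i)

  pathWithin-stable : ∀ f g s → toℕ s < f → toℕ s < g → pathWithin f s ≡ pathWithin g s
  pathWithin-stable (suc f) (suc g) fzero    _         _         = refl
  pathWithin-stable (suc f) (suc g) (fsuc i) (s≤s i<f) (s≤s i<g) =
    cong (_∷ʳ label (fsuc i))
      (pathWithin-stable f g (parent i) (≤-<-trans (parent≤ i) i<f) (≤-<-trans (parent≤ i) i<g))

  -- s is an ancestor of t iff path s ⊑ path t.
  path : Node → List ℕ
  path s = pathWithin (suc (toℕ s)) s

  path-fsuc : ∀ i → path (fsuc i) ≡ path (parent i) ∷ʳ label (fsuc i)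
  path-fsuc i =
    cong (_∷ʳ label (fsuc i)) (pathWithin-stable _ _ (parent i) (s≤s (parent≤ i)) ≤-refl)

  path-last : ∀ s → ∃[ q ] path s ≡ q ∷ʳ label s
  path-last fzero    = [] , refl
  path-last (fsuc i) = path (parent i) , path-fsuc i

  path-injective : ∀ {s t} → path s ≡ path t → s ≡ t
  path-injective {s} {t} e with path-last s | path-last t
  ... | q , es | r , et =
    toℕ-injective (+-cancelˡ-≡ offset _ _ (∷ʳ-injectiveʳ q r (trans (sym es) (trans e et))))

  path⊑-fsuc⁺ : ∀ {s} i → path s ⊑ path (parent i) → path s ⊑ path (fsuc i)
  path⊑-fsuc⁺ i p = subst (_ ⊑_) (sym (path-fsuc i)) (⊑-trans p ⊑-∷ʳ)

  path⊑-fsuc⁻ : ∀ {s} i → path s ⊑ path (fsuc i) → path s ⊑ path (parent i) ⊎ s ≡ fsuc i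
  path⊑-fsuc⁻ {s} i p with ⊑-∷ʳ⁻ (subst (path s ⊑_) (path-fsuc i) p)
  ... | inj₁ q = inj₁ q
  ... | inj₂ e = inj₂ (path-injective (trans e (sym (path-fsuc i))))

  _⊑?_ : ∀ s t → Dec (path s ⊑ path t)
  s ⊑? t = Prefix.prefix? Data.Nat._≟_ (path s) (path t)

  walk-leaves-subtree : ∀ {S : Node → Set} {s x y} → WalkIn (TreeAdj parent) S x y →
    path s ⊑ path x → ¬ path s ⊑ path y → ∃[ i ] s ≡ fsuc i × S (fsuc i) × S (parent i)
  walk-leaves-subtree (here _) s⊑x s⋢y = contradiction s⊑x s⋢y
  walk-leaves-subtree {S} {s} {x} (step {y = x′} Sx x~x′ w) s⊑x s⋢y with s ⊑? x′
  ... | yes s⊑x′ = walk-leaves-subtree w s⊑x′ s⋢y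
  ... | no s⋢x′ = leave x~x′
    where
      leave : TreeAdj parent x x′ → ∃[ i ] s ≡ fsuc i × S (fsuc i) × S (parent i)
      leave (up i) with path⊑-fsuc⁻ {s} i s⊑x
      ... | inj₁ s⊑p = contradiction s⊑p s⋢x′
      ... | inj₂ e   = i , e , Sx , walk-start w
      leave (down i) = contradiction (path⊑-fsuc⁺ {s} i s⊑x) s⋢x′

module Home {V : Set} {_~_ : V → V → Set} (_≟_ : DecidableEquality V)
            (T : TreeDecomposition V _~_) (offset : ℕ) where

  open TreeDecomposition T
  open RootPath offset parent parent< public
  open import Data.List.Membership.DecPropositional _≟_ using (_∈?_)

  Topmost : V → Node → Set
  Topmost w r = ∀ i → r ≡ fsuc i → ¬ w ∈ bag (parent i)

  climb : ∀ f w t → toℕ t < f → w ∈ bag t → ∃[ r ] w ∈ bag r × Topmost w r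
  climb (suc f) w fzero    _         w∈t = fzero , w∈t , λ _ ()
  climb (suc f) w (fsuc i) (s≤s i<f) w∈t with w ∈? bag (parent i)
  ... | yes w∈p = climb f w (parent i) (≤-<-trans (parent< i) i<f) w∈p
  ... | no w∉p  = fsuc i , w∈t , λ { _ refl → w∉p }

  topmostBag : ∀ w → ∃[ r ] w ∈ bag r × Topmost w r
  topmostBag w = climb _ w (proj₁ (vertexCov w)) ≤-refl (proj₂ (vertexCov w))

  home : V → Node
  home w = proj₁ (topmostBag w)

  home-∈ : ∀ w → w ∈ bag (home w)
  home-∈ w = proj₁ (proj₂ (topmostBag w))

  home-⊑ : ∀ {w t} → w ∈ bag t → path (home w) ⊑ path t
  home-⊑ {w} {t} w∈t with home w ⊑? t
  ... | yes h⊑t = h⊑t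
  ... | no h⋢t
    with walk-leaves-subtree {s = home w} (coherent w (home w) t (home-∈ w) w∈t) ⊑-refl h⋢t
  ...   | i , h≡i , _ , w∈p = contradiction w∈p (proj₂ (proj₂ (topmostBag w)) i h≡i)

  ∈-bag-between : ∀ {w s t} → w ∈ bag t → path (home w) ⊑ path s → path s ⊑ path t →
                  w ∈ bag s
  ∈-bag-between {w} {s} {t} w∈t h⊑s s⊑t with s ⊑? home w
  ... | yes s⊑h = subst (λ r → w ∈ bag r) (path-injective (⊑-antisym h⊑s s⊑h)) (home-∈ w)
  ... | no s⋢h with walk-leaves-subtree {s = s} (coherent w t (home w) w∈t (home-∈ w)) s⊑t s⋢h
  ...   | _ , refl , w∈s , _ = w∈s

length-concatMap : ∀ {A B : Set} (f : A → List B) xs →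
                   length (concatMap f xs) ≡ sum (map (λ x → length (f x)) xs)
length-concatMap f []       = refl
length-concatMap f (x ∷ xs) =
  trans (length-++ (f x)) (cong (length (f x) +_) (length-concatMap f xs))

length-concatMap-≤ : ∀ {A B : Set} {Δ} (f : A → List B) → (∀ x → length (f x) ≤ Δ) →
                     ∀ xs → length (concatMap f xs) ≤ length xs * Δ
length-concatMap-≤ f f≤Δ []       = z≤n
length-concatMap-≤ {Δ = Δ} f f≤Δ (x ∷ xs) = begin
  length (f x ++ concatMap f xs)           ≡⟨ length-++ (f x) ⟩
  length (f x) + length (concatMap f xs)   ≤⟨ +-mono-≤ (f≤Δ x) (length-concatMap-≤ f f≤Δ xs) ⟩
  Δ + length xs * Δ                        ∎
  where open ≤-Reasoning

module Incidence (G : Graph) where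

  open Graph G renaming (sym to adj-sym)

  Endpoint : Edge G → Fin n → Set
  Endpoint e x = Edge.u e ≡ x ⊎ Edge.v e ≡ x

  Joins : Edge G → Fin n → Fin n → Set
  Joins e x y = (Edge.u e ≡ x × Edge.v e ≡ y) ⊎ (Edge.u e ≡ y × Edge.v e ≡ x)

  edge-≡ : ∀ {e f : Edge G} → Edge.u e ≡ Edge.u f → Edge.v e ≡ Edge.v f → e ≡ f
  edge-≡ {edge u v u<v uv} {edge _ _ u<v′ uv′} refl refl =
    cong₂ (edge u v) (<-irrelevant u<v u<v′) (Decidable⇒UIP.≡-irrelevant Data.Bool._≟_ uv uv′)

  joins-unique : ∀ {e f : Edge G} {x y} → Joins e x y → Joins f x y → e ≡ f
  joins-unique (inj₁ (ux , vy)) (inj₁ (ux′ , vy′)) =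
    edge-≡ (trans ux (sym ux′)) (trans vy (sym vy′))
  joins-unique (inj₂ (uy , vx)) (inj₂ (uy′ , vx′)) =
    edge-≡ (trans uy (sym uy′)) (trans vx (sym vx′))
  joins-unique {edge _ _ x<y _} {edge _ _ y<x _} (inj₁ (refl , refl)) (inj₂ (refl , refl)) =
    contradiction y<x (<-asym x<y)
  joins-unique {edge _ _ y<x _} {edge _ _ x<y _} (inj₂ (refl , refl)) (inj₁ (refl , refl)) =
    contradiction y<x (<-asym x<y)

  joins-adj : ∀ {e : Edge G} {x y} → Joins e x y → adj x y ≡ true
  joins-adj {edge _ _ _ uv} (inj₁ (refl , refl)) = uv
  joins-adj {edge u v _ uv} (inj₂ (refl , refl)) = trans (adj-sym v u) uv

  joins-endpoint : ∀ {e : Edge G} {x y} → Joins e x y → Endpoint e x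
  joins-endpoint (inj₁ (ux , _)) = inj₁ ux
  joins-endpoint (inj₂ (_ , vx)) = inj₂ vx

  endpoint-cases : ∀ {e : Edge G} {x y z} → Joins e x y → Endpoint e z → z ≡ x ⊎ z ≡ y
  endpoint-cases (inj₁ (refl , _)) (inj₁ refl) = inj₁ refl
  endpoint-cases (inj₁ (_ , refl)) (inj₂ refl) = inj₂ refl
  endpoint-cases (inj₂ (refl , _)) (inj₁ refl) = inj₂ refl
  endpoint-cases (inj₂ (_ , refl)) (inj₂ refl) = inj₁ refl

  adj⇒≢ : ∀ {x y} → adj x y ≡ true → x ≢ y
  adj⇒≢ {x} xy refl with trans (sym xy) (irr x)
  ... | ()

  edgeOf : ∀ x y → adj x y ≡ true → Edge G
  edgeOf x y xy with <-cmp (toℕ x) (toℕ y)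
  ... | tri< x<y _ _ = edge x y x<y xy
  ... | tri≈ _ x≡y _ = contradiction (toℕ-injective x≡y) (adj⇒≢ xy)
  ... | tri> _ _ y<x = edge y x y<x (trans (adj-sym y x) xy)

  edgeOf-joins : ∀ x y xy → Joins (edgeOf x y xy) x y
  edgeOf-joins x y xy with <-cmp (toℕ x) (toℕ y)
  ... | tri< _ _ _   = inj₁ (refl , refl)
  ... | tri≈ _ x≡y _ = contradiction (toℕ-injective x≡y) (adj⇒≢ xy)
  ... | tri> _ _ _   = inj₂ (refl , refl)

  edgesIf : ∀ x y b → adj x y ≡ b → List (Edge G)
  edgesIf x y true  xy = edgeOf x y xy ∷ []
  edgesIf x y false _  = []

  length-edgesIf : ∀ x y b xy → length (edgesIf x y b xy) ≡ (if b then 1 else 0)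
  length-edgesIf x y true  _ = refl
  length-edgesIf x y false _ = refl

  ∈-edgesIf⁺ : ∀ {e : Edge G} {x y} → Joins e x y → ∀ b xy → e ∈ edgesIf x y b xy
  ∈-edgesIf⁺ {x = x} {y} j true  xy = here (joins-unique j (edgeOf-joins x y xy))
  ∈-edgesIf⁺ {e}          j false xy with () ← trans (sym (joins-adj {e} j)) xy

  ∈-edgesIf⁻ : ∀ {e : Edge G} {x y} b xy → e ∈ edgesIf x y b xy → Joins e x y
  ∈-edgesIf⁻ {x = x} {y} true xy (here refl) = edgeOf-joins x y xy

  edgesTo : Fin n → Fin n → List (Edge G)
  edgesTo x y = edgesIf x y (adj x y) refl

  incident : Fin n → List (Edge G)
  incident x = concatMap (edgesTo x) (allFin n)

  length-incident : ∀ x → length (incident x) ≡ degree G x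
  length-incident x = trans (length-concatMap (edgesTo x) (allFin n))
    (cong sum (map-cong (λ y → length-edgesIf x y (adj x y) refl) (allFin n)))

  ∈-incident⁺ : ∀ {e : Edge G} {x} → Endpoint e x → e ∈ incident x
  ∈-incident⁺ {e} {x} ex =
    let (y , j) = other ex in ∈-concatMap⁺ (edgesTo x) (lose (∈-allFin y) (∈-edgesIf⁺ j _ _))
    where
      other : Endpoint e x → ∃[ y ] Joins e x y
      other (inj₁ refl) = Edge.v e , inj₁ (refl , refl)
      other (inj₂ refl) = Edge.u e , inj₂ (refl , refl)

  ∈-incident⁻ : ∀ {e : Edge G} {x} → e ∈ incident x → Endpoint e x
  ∈-incident⁻ {e} {x} e∈ with satisfied (∈-concatMap⁻ (edgesTo x) {allFin n} e∈)
  ... | y , e∈y = joins-endpoint {e} (∈-edgesIf⁻ {e} (adj x y) refl e∈y)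

module DFSDrawing (G : Graph) (T : TreeDecomposition (Fin (Graph.n G)) (Adj G)) where

  open Graph G using (n)
  open TreeDecomposition T
  open Home Data.Fin._≟_ T n
  open Incidence G

  -- Node labels start at n, above every vertex label, so a root path is never a key.
  key : Fin n → List ℕ
  key w = path (home w) ∷ʳ toℕ w

  key-injective : ∀ {x y} → Pointwise _≡_ (key x) (key y) → x ≡ y
  key-injective {x} {y} e =
    toℕ-injective (∷ʳ-injectiveʳ (path (home x)) (path (home y)) (Pointwise-≡⇒≡ e))

  open Rank (Lex.<-isStrictTotalOrder <-isStrictTotalOrder) key key-injective

  drawing : CircularDrawing G
  drawing = rank , rank-injective

  position : Fin n → ℕ
  position w = toℕ (rank w)

  InSubtree : Node → Fin n → Set
  InSubtree t w = path t ⊑ key w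

  InSubtree-convex : ∀ t → ConvexAlong position (InSubtree t)
  InSubtree-convex t x∈ z∈ x<y y<z =
    ⊑-convex <-asym x∈ z∈ (rank-reflects x<y) (rank-reflects y<z)

  ⊑home⇒InSubtree : ∀ t w → path t ⊑ path (home w) → InSubtree t w
  ⊑home⇒InSubtree _ _ t⊑h = ⊑-trans t⊑h ⊑-∷ʳ

  InSubtree⇒⊑home : ∀ t w → InSubtree t w → path t ⊑ path (home w)
  InSubtree⇒⊑home t w t⊑k with ⊑-∷ʳ⁻ t⊑k
  ... | inj₁ t⊑h = t⊑h
  ... | inj₂ t≡k with path-last t
  ...   | q , t≡q = contradiction (∷ʳ-injectiveʳ q (path (home w)) (trans (sym t≡q) t≡k))
                      (>⇒≢ (<-≤-trans (toℕ<n w) (m≤m+n n (toℕ t))))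

  record Apex (e : Edge G) : Set where
    field
      apex       : Fin n
      apex-end   : Endpoint e apex
      apex-above : ∀ {y} → Endpoint e y → path (home apex) ⊑ path (home y)
      apex-in    : ∀ {y} → Endpoint e y → apex ∈ bag (home y)

  apexFrom : ∀ {e a b t} → Joins e a b → a ∈ bag t → b ∈ bag t →
             path (home a) ⊑ path (home b) → Apex e
  apexFrom {e} {a} j a∈t b∈t ha⊑hb = record
    { apex       = a
    ; apex-end   = joins-endpoint {e} j
    ; apex-above = λ ey → [ (λ { refl → ⊑-refl }) , (λ { refl → ha⊑hb }) ]′
                            (endpoint-cases {e} j ey)
    ; apex-in    = λ ey → [ (λ { refl → home-∈ a })
                          , (λ { refl → ∈-bag-between a∈t ha⊑hb (home-⊑ b∈t) }) ]′
                            (endpoint-cases {e} j ey)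
    }

  apexOf : ∀ e → Apex e
  apexOf (edge u v _ uv) with edgeCov u v uv
  ... | t , u∈t , v∈t with ⊑-comparable (home-⊑ u∈t) (home-⊑ v∈t)
  ...   | inj₁ hu⊑hv = apexFrom (inj₁ (refl , refl)) u∈t v∈t hu⊑hv
  ...   | inj₂ hv⊑hu = apexFrom (inj₂ (refl , refl)) v∈t u∈t hv⊑hu

  open module ApexOf e = Apex (apexOf e) using (apex; apex-end; apex-above; apex-in)

  root : Edge G → Node
  root e = home (apex e)

  crossing-enters-subtree : ∀ {e f} → Cross G drawing e f →
                            ∃[ x ] Endpoint e x × path (root f) ⊑ path (home x)
  crossing-enters-subtree {e} {f} e×f
    with crossing-chord-enters position (InSubtree (root f)) (InSubtree-convex (root f))
           G (Edge.u e) (Edge.v e)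
           (⊑home⇒InSubtree (root f) (Edge.u f) (apex-above f (inj₁ refl)))
           (⊑home⇒InSubtree (root f) (Edge.v f) (apex-above f (inj₂ refl))) e×f
  ... | inj₁ u∈ = Edge.u e , inj₁ refl , InSubtree⇒⊑home (root f) (Edge.u e) u∈
  ... | inj₂ v∈ = Edge.v e , inj₂ refl , InSubtree⇒⊑home (root f) (Edge.v e) v∈

  apex-descends : ∀ e f {y} → path (root f) ⊑ path (root e) → Endpoint f y →
                  path (root e) ⊑ path (home y) → apex f ∈ bag (root e)
  apex-descends e f rf⊑re fy re⊑y = ∈-bag-between (apex-in f fy) rf⊑re re⊑y

  crossing-apexes-share-bag : ∀ {e f} → Cross G drawing e f →
                              ∃[ t ] apex e ∈ bag t × apex f ∈ bag t
  crossing-apexes-share-bag {e} {f} e×f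
    with crossing-enters-subtree {e} {f} e×f | crossing-enters-subtree {f} {e} (Interleave-sym G e×f)
  ... | x , ex , rf⊑x | y , fy , re⊑y with ⊑-comparable rf⊑x (apex-above e ex)
  ...   | inj₁ rf⊑re = root e , home-∈ (apex e) , apex-descends e f rf⊑re fy re⊑y
  ...   | inj₂ re⊑rf = root f , apex-descends f e re⊑rf ex rf⊑x , home-∈ (apex f)

  edgeBag : Node → List (Edge G)
  edgeBag t = concatMap incident (bag t)

  ∈-edgeBag⁺ : ∀ {e x t} → Endpoint e x → x ∈ bag t → e ∈ edgeBag t
  ∈-edgeBag⁺ ex x∈t = ∈-concatMap⁺ incident (lose x∈t (∈-incident⁺ ex))

  ∈-edgeBag⁻ : ∀ {e t} → e ∈ edgeBag t → Edge.u e ∈ bag t ⊎ Edge.v e ∈ bag t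
  ∈-edgeBag⁻ {e} {t} e∈ with find (∈-concatMap⁻ incident {bag t} e∈)
  ... | x , x∈t , e∈x with ∈-incident⁻ e∈x
  ...   | inj₁ refl = inj₁ x∈t
  ...   | inj₂ refl = inj₂ x∈t

  edgeBag-connected : ∀ e → ConnectedSubset (TreeAdj parent) (λ t → e ∈ edgeBag t)
  edgeBag-connected (edge u v _ uv) =
    let (t , u∈t , v∈t) = edgeCov u v uv in
    connected-resp [ ∈-edgeBag⁺ (inj₁ refl) , ∈-edgeBag⁺ (inj₂ refl) ]′ ∈-edgeBag⁻
      (connected-∪ (coherent u) (coherent v) u∈t v∈t)

  crossingDecomposition : TreeDecomposition (Edge G) (Cross G drawing)
  crossingDecomposition = record
    { m         = m
    ; parent    = parent
    ; parent<   = parent<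
    ; bag       = edgeBag
    ; vertexCov = λ e → let (t , u∈t) = vertexCov (Edge.u e) in t , ∈-edgeBag⁺ (inj₁ refl) u∈t
    ; edgeCov   = λ e f e×f → let (t , e∈t , f∈t) = crossing-apexes-share-bag e×f in
                              t , ∈-edgeBag⁺ (apex-end e) e∈t , ∈-edgeBag⁺ (apex-end f) f∈t
    ; coherent  = edgeBag-connected
    }

  length-edgeBag : ∀ {Δ} → MaxDegreeAtMost G Δ → ∀ t → length (edgeBag t) ≤ length (bag t) * Δ
  length-edgeBag maxDeg t =
    length-concatMap-≤ incident (λ x → ≤-trans (≤-reflexive (length-incident x)) (maxDeg x)) (bag t)

crossing-treewidth : ∀ k Δ (G : Graph) → TreewidthLessThan (Fin (Graph.n G)) (Adj G) k →
  MaxDegreeAtMost G Δ → Σ (CircularDrawing G) λ D → TreewidthLessThan (Edge G) (Cross G D) (k * Δ)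
crossing-treewidth k Δ G (T , small) maxDeg =
  drawing , crossingDecomposition , λ t → ≤-trans (length-edgeBag maxDeg t) (*-monoˡ-≤ Δ (small t))
  where open DFSDrawing G T

TreewidthLessThan-mono : ∀ {V R b b′} → b ≤ b′ →
                         TreewidthLessThan V R b → TreewidthLessThan V R b′
TreewidthLessThan-mono b≤b′ (T , small) = T , λ t → ≤-trans (small t) b≤b′

n≤n^2 : ∀ n → n ≤ n ^ 2
n≤n^2 zero      = z≤n
n≤n^2 n@(suc _) = ≤-trans (m≤m*n n n) (≤-reflexive (cong (n *_) (sym (*-identityʳ n))))

kΔ≤bound : ∀ k Δ → k * Δ ≤ (6 * Δ + 1) * (18 * k * Δ) ^ 2
kΔ≤bound k Δ = begin
  k * Δ                            ≤⟨ m≤n*m (k * Δ) 18 ⟩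
  18 * (k * Δ)                     ≡⟨ *-assoc 18 k Δ ⟨
  18 * k * Δ                       ≤⟨ n≤n^2 (18 * k * Δ) ⟩
  (18 * k * Δ) ^ 2                 ≡⟨ *-identityˡ _ ⟨
  1 * (18 * k * Δ) ^ 2             ≤⟨ *-monoˡ-≤ ((18 * k * Δ) ^ 2) (m≤n+m 1 (6 * Δ)) ⟩
  (6 * Δ + 1) * (18 * k * Δ) ^ 2   ∎
  where open ≤-Reasoning

proposition18 : (k Δ : ℕ) (G : Graph) →
    TreewidthLessThan (Fin (Graph.n G)) (Adj G) k →
    MaxDegreeAtMost G Δ →
    Σ (CircularDrawing G) λ D →
      TreewidthLessThan (Edge G) (Cross G D) ((6 * Δ + 1) * (18 * k * Δ) ^ 2)
proposition18 k Δ G tw<k maxDeg =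
  let (D , tw<kΔ) = crossing-treewidth k Δ G tw<k maxDeg in
  D , TreewidthLessThan-mono (kΔ≤bound k Δ) tw<kΔ
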